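{- Work in Bishop-style constructive mathematics. For each fan $T$, the following are equivalent: (1) every pointwise continuous function $f\colon\mathbb{N}^{\mathbb{N}}\to\mathbb{N}$ (with $\mathbb{N}$ discrete) is uniformly continuous near $T$; (2) every monotone $\Pi^0_1$ bar of $T$ is uniform.
   Context: $\mathbb{N}^*$ is the set of finite sequences of natural numbers, $a*b$ concatenation, $\overline{\alpha}n$ the initial segment of length $n$ of $\alpha\in\mathbb{N}^{\mathbb{N}}$. A tree is an inhabited decidable subset of $\mathbb{N}^*$ closed under initial segments. A spread is a tree $T$ with $\forall a\in T\,\exists n\,(a*\langle n\rangle\in T)$; a path of $T$ is $\alpha$ with $\forall n\,(\overline{\alpha}n\in T)$, written $\alpha\in T$. A fan is a spread $T$ with $\forall a\in T\,\exists N\,\forall n\,[a*\langle n\rangle\in T\to n\le N]$. For a spread $T$, $P\subseteq T$ is a bar of $T$ if every path $\alpha$ of $T$ has some $n$ with $\overline{\alpha}n\in P$; a uniform bar if there is $N$ such that every path of $T$ has some $n\le N$ with $\overline{\alpha}n\in P$; $\Pi^0_1$ if $P=\bigcap_n B_n$ with each $B_n\subseteq T$ decidable; monotone if $a\in P$, $a*b\in T$ imply $a*b\in P$. Baire space $\mathbb{N}^{\mathbb{N}}$ carries the metric $d(\alpha,\beta)=\inf\{2^{ -n}\mid\overline{\alpha}n=\overline{\beta}n\}$. A function $f\colon\mathbb{N}^{\mathbb{N}}\to\mathbb{N}$ is uniformly continuous near a fan $T$ if there exists $N$ such that for all paths $\alpha$ of $T$ and all $\beta\in\mathbb{N}^{\mathbb{N}}$,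 $\overline{\alpha}N=\overline{\beta}N$ implies $f(\alpha)=f(\beta)$. -}

module Defs where

open import Data.Nat using (ℕ; _≤_)
open import Data.Bool using (Bool; true)
open import Data.List using (List; []; _∷_; _++_; [_]; applyUpTo)
open import Data.Product using (Σ; ∃; _×_; _,_)
open import Relation.Binary.PropositionalEquality using (_≡_)

-- ℕ* = List ℕ ; a * ⟨n⟩ = a ++ [ n ]
-- initial segment ᾱn = [α 0, …, α (n-1)]
initSeg : (ℕ → ℕ) → ℕ → List ℕ
initSeg α n = applyUpTo α n

DecSubset : Set
DecSubset = List ℕ → Bool

_∈ᵈ_ : List ℕ → DecSubset → Set
a ∈ᵈ T = T a ≡ true

IsTree : DecSubset → Set
IsTree T = (∃ λ a → a ∈ᵈ T) × (∀ a b → (a ++ b) ∈ᵈ T → a ∈ᵈ T)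

IsSpread : DecSubset → Set
IsSpread T = IsTree T × (∀ a → a ∈ᵈ T → ∃ λ n → (a ++ [ n ]) ∈ᵈ T)

IsFan : DecSubset → Set
IsFan T = IsSpread T ×
  (∀ a → a ∈ᵈ T → ∃ λ N → ∀ n → (a ++ [ n ]) ∈ᵈ T → n ≤ N)

IsPath : DecSubset → (ℕ → ℕ) → Set
IsPath T α = ∀ n → initSeg α n ∈ᵈ T

_⊆ᵀ_ : (List ℕ → Set) → DecSubset → Set
P ⊆ᵀ T = ∀ a → P a → a ∈ᵈ T

IsBar : DecSubset → (List ℕ → Set) → Set
IsBar T P = P ⊆ᵀ T × (∀ α → IsPath T α → ∃ λ n → P (initSeg α n))

IsUniformBar : DecSubset → (List ℕ → Set) → Set
IsUniformBar T P = P ⊆ᵀ T ×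
  (∃ λ N → ∀ α → IsPath T α → ∃ λ n → n ≤ N × P (initSeg α n))

IsΠ⁰₁ : DecSubset → (List ℕ → Set) → Set
IsΠ⁰₁ T P = Σ (ℕ → DecSubset) λ B →
  (∀ n a → a ∈ᵈ B n → a ∈ᵈ T) ×
  (∀ a → (P a → ∀ n → a ∈ᵈ B n) × ((∀ n → a ∈ᵈ B n) → P a))

IsMonotone : DecSubset → (List ℕ → Set) → Set
IsMonotone T P = ∀ a b → P a → (a ++ b) ∈ᵈ T → P (a ++ b)

-- pointwise continuity of f : ℕ^ℕ → ℕ (Baire metric, ℕ discrete):
-- d(α,β) ≤ 2^{-N} iff ᾱN = β̄N
IsPointwiseContinuous : ((ℕ → ℕ) → ℕ) → Set
IsPointwiseContinuous f =
  ∀ α → ∃ λ N → ∀ β → initSeg α N ≡ initSeg β N → f α ≡ f β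

IsUniformlyContinuousNear : DecSubset → ((ℕ → ℕ) → ℕ) → Set
IsUniformlyContinuousNear T f =
  ∃ λ N → ∀ α → IsPath T α → ∀ β → initSeg α N ≡ initSeg β N → f α ≡ f β

module Submission where

-- (bars ⇒ continuity).  For a pointwise continuous f, the nodes a ∈ T on which
-- f is constant (f (a * c * 0^ω) = f (a * 0^ω) for all c ∈ ℕ*) form a monotone
-- bar; it is Π⁰₁ because "for all c" can be checked on the finitely many c of
-- size ≤ k, for each k.  A uniform bound N for this bar is a modulus of uniform
-- continuity near T.
--
-- (continuity ⇒ bars).  For a monotone Π⁰₁ bar P = ⋂ₖ Bₖ we build a test
-- function f: while β stays inside T the value is 0; if β leaves T just after
-- the node β̄L, then f β = 0 exactly when β̄L ∈ B_{β(L+1)}.  Using a retraction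
-- of ℕ^ℕ onto the paths of T and the bar P, f is pointwise continuous.  If f is
-- uniformly continuous near T with modulus N, then for each path α and each j,
-- probing f at the sequence that follows ᾱN, leaves the fan T, and then
-- carries j, shows ᾱN ∈ Bⱼ; hence ᾱN ∈ P for every path α.

open import Defs
open import Data.Nat using (ℕ; zero; suc; _+_; _≤_; _≤?_; _≟_; z≤n; s≤s)
open import Data.Nat.Properties
open import Data.Bool using (Bool; true; false; _∧_; if_then_else_)
open import Data.Bool.Properties using (¬-not)
open import Data.List using (List; []; _∷_; _++_; [_]; applyUpTo; take)
open import Data.List.Properties using (applyUpTo-∷ʳ; ∷-injectiveˡ; ++-assoc; ++-identityʳ; ++-cancelˡ)
open import Data.Product using (Σ; ∃; _×_; _,_; proj₁; proj₂)
open import Data.Sum using (_⊎_; inj₁; inj₂)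
open import Data.Empty using (⊥)
open import Data.Unit using (⊤; tt)
open import Function using (_∘_)
open import Function.Bundles using (_⇔_; mk⇔)
open import Relation.Nullary using (Dec; yes; no; does; contradiction)
open import Relation.Nullary.Decidable using (dec-true)
open import Relation.Binary.PropositionalEquality hiding ([_])
open ≡-Reasoning

initSeg-+ : ∀ (α : ℕ → ℕ) m k → initSeg α (m + k) ≡ initSeg α m ++ initSeg (λ i → α (m + i)) k
initSeg-+ α zero    k = refl
initSeg-+ α (suc m) k = cong (α 0 ∷_) (initSeg-+ (α ∘ suc) m k)

initSeg-extends : ∀ (α : ℕ → ℕ) {m n} → m ≤ n → ∃ λ c → initSeg α n ≡ initSeg α m ++ c
initSeg-extends α {m} m≤n = _ , trans (cong (initSeg α) (sym (m+[n∸m]≡n m≤n))) (initSeg-+ α m _)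

take-initSeg : ∀ (α : ℕ → ℕ) {m n} → m ≤ n → take m (initSeg α n) ≡ initSeg α m
take-initSeg α {zero}          _         = refl
take-initSeg α {suc m} {suc n} (s≤s m≤n) = cong (α 0 ∷_) (take-initSeg (α ∘ suc) m≤n)

initSeg-restrict : ∀ {α β : ℕ → ℕ} {m n} → m ≤ n → initSeg α n ≡ initSeg β n → initSeg α m ≡ initSeg β m
initSeg-restrict {α} {β} m≤n e =
  trans (sym (take-initSeg α m≤n)) (trans (cong (take _) e) (take-initSeg β m≤n))

initSeg-last : ∀ {α β : ℕ → ℕ} i → initSeg α (suc i) ≡ initSeg β (suc i) → α i ≡ β i
initSeg-last {α} {β} i e = ∷-injectiveˡ (++-cancelˡ (initSeg α i) [ α i ] [ β i ] (begin
  initSeg α i ++ [ α i ]  ≡⟨ applyUpTo-∷ʳ α i ⟩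
  initSeg α (suc i)       ≡⟨ e ⟩
  initSeg β (suc i)       ≡⟨ sym (applyUpTo-∷ʳ β i) ⟩
  initSeg β i ++ [ β i ]  ≡⟨ cong (_++ [ β i ]) (sym (initSeg-restrict (n≤1+n i) e)) ⟩
  initSeg α i ++ [ β i ]  ∎))

root : ∀ {T} → IsTree T → [] ∈ᵈ T
root ((a , a∈T) , closed) = closed [] a a∈T

initSeg-in-tree : ∀ {T} → IsTree T → ∀ (α : ℕ → ℕ) {m n} → m ≤ n → initSeg α n ∈ᵈ T → initSeg α m ∈ᵈ T
initSeg-in-tree {T} (_ , closed) α {m} m≤n αn∈T =
  let (c , e) = initSeg-extends α m≤n in closed (initSeg α m) c (subst (_∈ᵈ T) e αn∈T)

extend : List ℕ → ℕ → ℕ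
extend []      i       = 0
extend (x ∷ a) zero    = x
extend (x ∷ a) (suc i) = extend a i

initSeg-extend : ∀ (α : ℕ → ℕ) n b → initSeg (extend (initSeg α n ++ b)) n ≡ initSeg α n
initSeg-extend α zero    b = refl
initSeg-extend α (suc n) b = cong (α 0 ∷_) (initSeg-extend (α ∘ suc) n b)

extend-beyond : ∀ (α : ℕ → ℕ) n b i → extend (initSeg α n ++ b) (n + i) ≡ extend b i
extend-beyond α zero    b i = refl
extend-beyond α (suc n) b i = extend-beyond (α ∘ suc) n b i

probe : (ℕ → ℕ) → ℕ → ℕ → ℕ → ℕ → ℕ
probe α n x j = extend (initSeg α n ++ x ∷ j ∷ [])

probe-step : ∀ α n x j → initSeg (probe α n x j) (suc n) ≡ initSeg α n ++ [ x ]
probe-step α n x j = begin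
  initSeg γ (suc n)        ≡⟨ sym (applyUpTo-∷ʳ γ n) ⟩
  initSeg γ n ++ [ γ n ]   ≡⟨ cong₂ (λ a y → a ++ [ y ]) (initSeg-extend α n _) γn≡x ⟩
  initSeg α n ++ [ x ]     ∎
  where
  γ = probe α n x j
  γn≡x : γ n ≡ x
  γn≡x = subst (λ k → γ k ≡ x) (+-identityʳ n) (extend-beyond α n _ 0)

probe-query : ∀ α n x j → probe α n x j (suc n) ≡ j
probe-query α n x j =
  subst (λ k → probe α n x j k ≡ j) (trans (+-suc n 0) (cong suc (+-identityʳ n))) (extend-beyond α n _ 1)

∧-elimˡ : ∀ {a b} → a ∧ b ≡ true → a ≡ true
∧-elimˡ {true} _ = refl

∧-elimʳ : ∀ {a b} → a ∧ b ≡ true → b ≡ true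
∧-elimʳ {true} b≡true = b≡true

∧-intro : ∀ {a b} → a ≡ true → b ≡ true → a ∧ b ≡ true
∧-intro refl refl = refl

does-true : ∀ {A : Set} (a? : Dec A) → does a? ≡ true → A
does-true (yes a) _ = a

-- Quantifying over ℕ* by finite checks

allUpTo : ℕ → (ℕ → Bool) → Bool
allUpTo zero    p = p 0
allUpTo (suc m) p = p (suc m) ∧ allUpTo m p

allUpTo-sound : ∀ m p {x} → allUpTo m p ≡ true → x ≤ m → p x ≡ true
allUpTo-sound zero    p all z≤n = all
allUpTo-sound (suc m) p all x≤1+m with m≤n⇒m<n∨m≡n x≤1+m
... | inj₁ (s≤s x≤m) = allUpTo-sound m p (∧-elimʳ all) x≤m
... | inj₂ refl      = ∧-elimˡ all

allUpTo-complete : ∀ m p → (∀ x → p x ≡ true) → allUpTo m p ≡ true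
allUpTo-complete zero    p all = all 0
allUpTo-complete (suc m) p all = ∧-intro (all (suc m)) (allUpTo-complete m p all)

Within : ℕ → ℕ → List ℕ → Set
Within l       m []      = ⊤
Within zero    m (x ∷ c) = ⊥
Within (suc l) m (x ∷ c) = x ≤ m × Within l m c

allLists : ℕ → ℕ → (List ℕ → Bool) → Bool
allLists zero    m p = p []
allLists (suc l) m p = p [] ∧ allUpTo m (λ x → allLists l m (p ∘ (x ∷_)))

allLists-sound : ∀ l m p c → allLists l m p ≡ true → Within l m c → p c ≡ true
allLists-sound zero    m p []      all _ = all
allLists-sound (suc l) m p []      all _ = ∧-elimˡ all
allLists-sound (suc l) m p (x ∷ c) all (x≤m , c-within) =
  allLists-sound l m (p ∘ (x ∷_)) c (allUpTo-sound m _ (∧-elimʳ all) x≤m) c-within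

allLists-complete : ∀ l m p → (∀ c → p c ≡ true) → allLists l m p ≡ true
allLists-complete zero    m p all = all []
allLists-complete (suc l) m p all =
  ∧-intro (all []) (allUpTo-complete m _ (λ x → allLists-complete l m _ (all ∘ (x ∷_))))

-- size c bounds both the length and the entries of c.
size : List ℕ → ℕ
size []      = 0
size (x ∷ c) = suc (x + size c)

within-size : ∀ c {l m} → size c ≤ l → size c ≤ m → Within l m c
within-size []      _         _       = tt
within-size (x ∷ c) (s≤s s≤l) 1+s≤m =
  ≤-trans (m≤m+n x (size c)) (≤-trans (n≤1+n _) 1+s≤m) ,
  within-size c (≤-trans (m≤n+m (size c) x) s≤l) (≤-trans (m≤n+m (size c) x) (≤-trans (n≤1+n _) 1+s≤m))

-- A Boolean test holds for all c ∈ ℕ* iff it passes every finite check allLists k k.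
-- This is what makes a universal quantifier over ℕ* a Π⁰₁ condition.
allLists-exhaustive : ∀ p → (∀ k → allLists k k p ≡ true) → ∀ c → p c ≡ true
allLists-exhaustive p all c =
  allLists-sound (size c) (size c) p c (all (size c)) (within-size c ≤-refl ≤-refl)

-- (every monotone Π⁰₁ bar is uniform) ⇒ (pointwise continuity implies uniform continuity)

module LocallyConstantBar (T : DecSubset) (f : (ℕ → ℕ) → ℕ) (f-cont : IsPointwiseContinuous f) where

  -- f is constant on all sequences through a (represented by their zero-extensions).
  ConstantOn : List ℕ → Set
  ConstantOn a = ∀ c → f (extend (a ++ c)) ≡ f (extend a)

  Constant : List ℕ → Set
  Constant a = a ∈ᵈ T × ConstantOn a

  checkedUpTo : ℕ → DecSubset
  checkedUpTo k a = T a ∧ allLists k k (λ c → does (f (extend (a ++ c)) ≟ f (extend a)))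

  constant-Π⁰₁ : IsΠ⁰₁ T Constant
  constant-Π⁰₁ = checkedUpTo , (λ _ _ → ∧-elimˡ) , λ a → checked a , constant a
    where
    checked : ∀ a → Constant a → ∀ k → a ∈ᵈ checkedUpTo k
    checked a (a∈T , const) k =
      ∧-intro a∈T (allLists-complete k k _ (λ c → dec-true (_ ≟ _) (const c)))

    constant : ∀ a → (∀ k → a ∈ᵈ checkedUpTo k) → Constant a
    constant a checks = ∧-elimˡ (checks 0) ,
      λ c → does-true (_ ≟ _) (allLists-exhaustive _ (λ k → ∧-elimʳ (checks k)) c)

  constant-monotone : IsMonotone T Constant
  constant-monotone a b (_ , const) ab∈T = ab∈T , λ c → begin
    f (extend ((a ++ b) ++ c))  ≡⟨ cong (f ∘ extend) (++-assoc a b c) ⟩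
    f (extend (a ++ (b ++ c)))  ≡⟨ const (b ++ c) ⟩
    f (extend a)                ≡⟨ sym (const b) ⟩
    f (extend (a ++ b))         ∎

  -- A modulus of continuity N at a path α makes f constant on ᾱN.
  constant-bar : IsBar T Constant
  constant-bar = (λ _ → proj₁) , λ α α∈T →
    let (N , modulus) = f-cont α
        near : ∀ c → f α ≡ f (extend (initSeg α N ++ c))
        near c = modulus _ (sym (initSeg-extend α N c))
    in N , α∈T N , λ c →
      trans (sym (near c)) (trans (near []) (cong (f ∘ extend) (++-identityʳ (initSeg α N))))

  constant-cylinder : ∀ {a} → ConstantOn a → ∀ β n → initSeg β n ≡ a → f β ≡ f (extend a)
  constant-cylinder {a} const β n βn≡a = begin
    f β                                   ≡⟨ modulus _ (initSeg-restrict (m≤n+m K n) (sym (initSeg-extend β (n + K) []))) ⟩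
    f (extend (initSeg β (n + K) ++ []))  ≡⟨ cong (f ∘ extend) βn+K≡ac ⟩
    f (extend (a ++ c))                   ≡⟨ const c ⟩
    f (extend a)                          ∎
    where
    K = proj₁ (f-cont β)
    modulus = proj₂ (f-cont β)
    c = initSeg (λ i → β (n + i)) K
    βn+K≡ac : initSeg β (n + K) ++ [] ≡ a ++ c
    βn+K≡ac = trans (++-identityʳ _) (trans (initSeg-+ β n K) (cong (_++ c) βn≡a))

  uniformly-continuous : IsUniformBar T Constant → IsUniformlyContinuousNear T f
  uniformly-continuous (_ , N , uniform) = N , λ α α∈T β αN≡βN →
    let (n , n≤N , (_ , const)) = uniform α α∈T in
    trans (constant-cylinder const α n refl)
          (sym (constant-cylinder const β n (sym (initSeg-restrict n≤N αN≡βN))))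

-- (pointwise continuity implies uniform continuity) ⇒ (every monotone Π⁰₁ bar is uniform)

-- Every spread is a retract of ℕ^ℕ: ρ β follows β as long as β stays in T,
-- and otherwise continues along some path of T.
module Retraction (T : DecSubset) (spread : IsSpread T) where

  choose : (a : List ℕ) → a ∈ᵈ T → ℕ → ℕ
  choose a a∈T x with T (a ++ [ x ])
  ... | true  = x
  ... | false = proj₁ (proj₂ spread a a∈T)

  choose-∈ : ∀ a a∈T x → (a ++ [ choose a a∈T x ]) ∈ᵈ T
  choose-∈ a a∈T x with T (a ++ [ x ]) in ax∈T
  ... | true  = ax∈T
  ... | false = proj₂ (proj₂ spread a a∈T)

  choose-allowed : ∀ a a∈T x → (a ++ [ x ]) ∈ᵈ T → choose a a∈T x ≡ x
  choose-allowed a a∈T x ax∈T with T (a ++ [ x ])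
  choose-allowed a a∈T x refl | true = refl

  node : (ℕ → ℕ) → ℕ → Σ (List ℕ) (_∈ᵈ T)
  node β zero    = [] , root (proj₁ spread)
  node β (suc k) = let (a , a∈T) = node β k in a ++ [ choose a a∈T (β k) ] , choose-∈ a a∈T (β k)

  ρ : (ℕ → ℕ) → ℕ → ℕ
  ρ β k = let (a , a∈T) = node β k in choose a a∈T (β k)

  initSeg-ρ : ∀ β n → initSeg (ρ β) n ≡ proj₁ (node β n)
  initSeg-ρ β zero    = refl
  initSeg-ρ β (suc n) = trans (sym (applyUpTo-∷ʳ (ρ β) n)) (cong (_++ [ ρ β n ]) (initSeg-ρ β n))

  ρ-path : ∀ β → IsPath T (ρ β)
  ρ-path β n = subst (_∈ᵈ T) (sym (initSeg-ρ β n)) (proj₂ (node β n))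

  node-fixes : ∀ β n → initSeg β n ∈ᵈ T → proj₁ (node β n) ≡ initSeg β n
  node-fixes β zero    _         = refl
  node-fixes β (suc n) βn+1∈T = begin
    proj₁ (node β n) ++ [ ρ β n ]  ≡⟨ cong₂ (λ a x → a ++ [ x ]) βn≡ (choose-allowed _ _ _ step∈T) ⟩
    initSeg β n ++ [ β n ]         ≡⟨ applyUpTo-∷ʳ β n ⟩
    initSeg β (suc n)              ∎
    where
    βn≡ : proj₁ (node β n) ≡ initSeg β n
    βn≡ = node-fixes β n (initSeg-in-tree (proj₁ spread) β (n≤1+n n) βn+1∈T)
    step∈T : (proj₁ (node β n) ++ [ β n ]) ∈ᵈ T
    step∈T = subst (_∈ᵈ T) (sym (trans (cong (_++ [ β n ]) βn≡) (applyUpTo-∷ʳ β n))) βn+1∈T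

  ρ-fixes : ∀ β n → initSeg β n ∈ᵈ T → initSeg (ρ β) n ≡ initSeg β n
  ρ-fixes β n βn∈T = trans (initSeg-ρ β n) (node-fixes β n βn∈T)

module ExitPoints (T : DecSubset) (tree : IsTree T) where

  ExitsAt : (ℕ → ℕ) → ℕ → Set
  ExitsAt β L = initSeg β L ∈ᵈ T × T (initSeg β (suc L)) ≡ false

  inside-before-exit : ∀ {β L n} → ExitsAt β L → initSeg β n ∈ᵈ T → n ≤ L
  inside-before-exit {β} {L} {n} (_ , βL+1∉T) βn∈T with n ≤? L
  ... | yes n≤L = n≤L
  ... | no  n≰L = contradiction (trans (sym (initSeg-in-tree tree β (≰⇒> n≰L) βn∈T)) βL+1∉T) λ ()

  exit-unique : ∀ {β L L′} → ExitsAt β L → ExitsAt β L′ → L ≡ L′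
  exit-unique exit exit′ = ≤-antisym (inside-before-exit exit′ (proj₁ exit)) (inside-before-exit exit (proj₁ exit′))

  exits-local : ∀ {β γ L} → initSeg β (suc L) ≡ initSeg γ (suc L) → ExitsAt β L → ExitsAt γ L
  exits-local {L = L} e (βL∈T , βL+1∉T) =
    subst (_∈ᵈ T) (initSeg-restrict (n≤1+n L) e) βL∈T , trans (cong T (sym e)) βL+1∉T

  lastInside : (ℕ → ℕ) → ℕ → ℕ
  lastInside β zero    = 0
  lastInside β (suc n) = if T (initSeg β n) then n else lastInside β n

  lastInside-exits : ∀ β n → T (initSeg β n) ≡ false → ExitsAt β (lastInside β n)
  lastInside-exits β zero    βn∉T = contradiction (trans (sym (root tree)) βn∉T) λ ()
  lastInside-exits β (suc n) βn+1∉T with T (initSeg β n) in βn∈T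
  ... | true  = βn∈T , βn+1∉T
  ... | false = lastInside-exits β n βn∈T

  inside-or-exit : ∀ β n → initSeg β n ∈ᵈ T ⊎ ExitsAt β (lastInside β n)
  inside-or-exit β n with T (initSeg β n) in βn∈T
  ... | true  = inj₁ refl
  ... | false = inj₂ (lastInside-exits β n βn∈T)

module TestFunction (T : DecSubset) (fan : IsFan T) (P : List ℕ → Set)
                    (P-bar : IsBar T P) (P-mono : IsMonotone T P) (P-Π⁰₁ : IsΠ⁰₁ T P) where

  tree : IsTree T
  tree = proj₁ (proj₁ fan)

  open Retraction T (proj₁ fan)
  open ExitPoints T tree

  B : ℕ → DecSubset
  B = proj₁ P-Π⁰₁

  P⊆B : ∀ {a} → P a → ∀ j → a ∈ᵈ B j
  P⊆B {a} = proj₁ (proj₂ (proj₂ P-Π⁰₁) a)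

  B⊆P : ∀ {a} → (∀ j → a ∈ᵈ B j) → P a
  B⊆P {a} = proj₂ (proj₂ (proj₂ P-Π⁰₁) a)

  P-along : ∀ {β n L} → P (initSeg β n) → n ≤ L → initSeg β L ∈ᵈ T → P (initSeg β L)
  P-along {β} p n≤L βL∈T =
    let (c , e) = initSeg-extends β n≤L in subst P (sym e) (P-mono _ c p (subst (_∈ᵈ T) e βL∈T))

  exitValue : (ℕ → ℕ) → ℕ → ℕ
  exitValue β L = if B (β (suc L)) (initSeg β L) then 0 else 1

  exitValue-barred : ∀ {β n L} → P (initSeg β n) → n ≤ L → initSeg β L ∈ᵈ T → exitValue β L ≡ 0
  exitValue-barred {β} {L = L} p n≤L βL∈T rewrite P⊆B (P-along p n≤L βL∈T) (β (suc L)) = refl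

  exitValue-zero : ∀ β L → exitValue β L ≡ 0 → initSeg β L ∈ᵈ B (β (suc L))
  exitValue-zero β L value≡0 with B (β (suc L)) (initSeg β L)
  ... | true  = refl
  ... | false = contradiction value≡0 λ ()

  exitValue-local : ∀ {β γ L} → initSeg β (suc (suc L)) ≡ initSeg γ (suc (suc L)) → exitValue β L ≡ exitValue γ L
  exitValue-local {β} {γ} {L} e = cong₂ (λ j a → if B j a then 0 else 1)
    (initSeg-last {β} {γ} (suc L) e) (initSeg-restrict {β} {γ} (≤-trans (n≤1+n L) (n≤1+n _)) e)

  barIndex : (ℕ → ℕ) → ℕ
  barIndex β = proj₁ (proj₂ P-bar (ρ β) (ρ-path β))

  barred-at-barIndex : ∀ {β} → initSeg β (barIndex β) ∈ᵈ T → P (initSeg β (barIndex β))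
  barred-at-barIndex {β} βn∈T = subst P (ρ-fixes β _ βn∈T) (proj₂ (proj₂ P-bar (ρ β) (ρ-path β)))

  f : (ℕ → ℕ) → ℕ
  f β = if T (initSeg β (barIndex β)) then 0 else exitValue β (lastInside β (barIndex β))

  f-exit : ∀ {β L} → ExitsAt β L → f β ≡ exitValue β L
  f-exit {β} exit with T (initSeg β (barIndex β)) in βn∈T
  ... | true  = sym (exitValue-barred (barred-at-barIndex βn∈T) (inside-before-exit exit βn∈T) (proj₁ exit))
  ... | false = cong (exitValue β) (exit-unique (lastInside-exits β _ βn∈T) exit)

  f-barred : ∀ {β n} → P (initSeg β n) → f β ≡ 0
  f-barred {β} p with T (initSeg β (barIndex β)) in βn∈T
  ... | true  = refl
  ... | false =
    let exit = lastInside-exits β _ βn∈T in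
    exitValue-barred p (inside-before-exit exit (proj₁ P-bar _ p)) (proj₁ exit)

  -- f β is determined by β̄(barIndex β) if β stays in T that long, otherwise by
  -- β̄(L + 2) where L is the exit point.
  f-continuous : IsPointwiseContinuous f
  f-continuous β with inside-or-exit β (barIndex β)
  ... | inj₁ βn∈T = barIndex β , λ γ e → trans (f-barred p) (sym (f-barred (subst P e p)))
    where p = barred-at-barIndex βn∈T
  ... | inj₂ exit = suc (suc (lastInside β (barIndex β))) , λ γ e →
    trans (f-exit exit) (trans (exitValue-local e) (sym (f-exit (exits-local (initSeg-restrict {β} {γ} (n≤1+n _) e) exit))))

  -- A value that no child of ᾱN carries, by the fan property.
  escape : ∀ α → IsPath T α → ℕ → ℕ
  escape α α∈T N = suc (proj₁ (proj₂ fan (initSeg α N) (α∈T N)))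

  probe-exits : ∀ α α∈T N j → ExitsAt (probe α N (escape α α∈T N) j) N
  probe-exits α α∈T N j =
    subst (_∈ᵈ T) (sym (initSeg-extend α N _)) (α∈T N) ,
    trans (cong T (probe-step α N _ j)) (¬-not λ child∈T → 1+n≰n (proj₂ (proj₂ fan (initSeg α N) (α∈T N)) _ child∈T))

  -- With a modulus N of uniform continuity, f at the probe equals f α = 0, so ᾱN ∈ Bⱼ.
  uniform-bar : IsUniformlyContinuousNear T f → IsUniformBar T P
  uniform-bar (N , uniform) = proj₁ P-bar , N , λ α α∈T → N , ≤-refl , B⊆P (in-B α α∈T)
    where
    in-B : ∀ α → IsPath T α → ∀ j → initSeg α N ∈ᵈ B j
    in-B α α∈T j = subst₂ (λ k a → a ∈ᵈ B k) (probe-query α N _ j) (initSeg-extend α N _)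
      (exitValue-zero γ N (begin
        exitValue γ N  ≡⟨ sym (f-exit (probe-exits α α∈T N j)) ⟩
        f γ            ≡⟨ sym (uniform α α∈T γ (sym (initSeg-extend α N _))) ⟩
        f α            ≡⟨ f-barred (proj₂ (proj₂ P-bar α α∈T)) ⟩
        0              ∎))
      where γ = probe α N (escape α α∈T N) j

UniformContinuityPrinciple : DecSubset → Set
UniformContinuityPrinciple T = ∀ (f : (ℕ → ℕ) → ℕ) → IsPointwiseContinuous f → IsUniformlyContinuousNear T f

UniformBarPrinciple : DecSubset → Set₁
UniformBarPrinciple T = ∀ (P : List ℕ → Set) → IsBar T P → IsMonotone T P → IsΠ⁰₁ T P → IsUniformBar T P

continuity⇒bars : ∀ T → IsFan T → UniformContinuityPrinciple T → UniformBarPrinciple T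
continuity⇒bars T fan uc P P-bar P-mono P-Π⁰₁ = uniform-bar (uc f f-continuous)
  where open TestFunction T fan P P-bar P-mono P-Π⁰₁

-- This direction holds for every decidable T.
bars⇒continuity : ∀ T → UniformBarPrinciple T → UniformContinuityPrinciple T
bars⇒continuity T uniformBars f f-cont =
  uniformly-continuous (uniformBars Constant constant-bar constant-monotone constant-Π⁰₁)
  where open LocallyConstantBar T f f-cont

proposition4p3 : (T : DecSubset) → IsFan T →
    ((∀ (f : (ℕ → ℕ) → ℕ) → IsPointwiseContinuous f → IsUniformlyContinuousNear T f)
      ⇔
     (∀ (P : List ℕ → Set) → IsBar T P → IsMonotone T P → IsΠ⁰₁ T P → IsUniformBar T P))
proposition4p3 T fan = mk⇔ (continuity⇒bars T fan) (bars⇒continuity T)
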